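{- Let $M$ be a loopless rank-$4$ hypermodular matroid. The following are equivalent: (i) $M$ is modular; (ii) for every point $P$ and every line $\ell$ of $M$, there is a plane of $M$ containing both $P$ and $\ell$; (iii) every two lines of $M$ that intersect at a point lie on a common plane of $M$.
   Context: For a loopless matroid $M$ and a flat $X$, the subspace $\eta(M/X)$ of $M$ is the contraction $M/X$ regarded as a subspace; the subspaces form a lattice dual to the lattice of flats, so $\eta(M/X)$ is contained in (lies on) $\eta(M/Y)$ iff $Y\subseteq X$. The dimension of $\eta(M/X)$ is $r(M)-r(X)-1$; a point, line, plane is a subspace of dimension $0,1,2$ respectively. Thus in rank $4$, points correspond to rank-$3$ flats, lines to rank-$2$ flats, planes to rank-$1$ flats. Two lines intersect at a point if some point lies on both. A pair of flats $\{A,B\}$ is modular if $r(A\cup B)+r(A\cap B)=r(A)+r(B)$; $M$ is modular if all pairs of flats are modular; a rank-$4$ matroid is hypermodular if every pair of rank-$3$ flats is modular. -}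

module Defs where

open import Data.Nat using (ℕ; _≤_; _<_; _+_)
open import Data.Fin using (Fin)
open import Data.Fin.Subset using (Subset; _⊆_; _∪_; _∩_; ⁅_⁆; ∣_∣; ⊤; _∉_)
open import Data.Product using (Σ; _×_; ∃-syntax)
open import Relation.Binary.PropositionalEquality using (_≡_)

record Matroid (n : ℕ) : Set where
  field
    r        : Subset n → ℕ
    r-bound  : ∀ X → r X ≤ ∣ X ∣
    r-mono   : ∀ {X Y} → X ⊆ Y → r X ≤ r Y
    r-submod : ∀ X Y → r (X ∪ Y) + r (X ∩ Y) ≤ r X + r Y

module _ {n : ℕ} (M : Matroid n) where
  open Matroid M

  rankM : ℕ
  rankM = r ⊤

  Loopless : Set
  Loopless = ∀ e → r ⁅ e ⁆ ≡ 1

  IsFlat : Subset n → Set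
  IsFlat X = ∀ e → e ∉ X → r X < r (X ∪ ⁅ e ⁆)

  IsFlatOfRank : ℕ → Subset n → Set
  IsFlatOfRank k X = IsFlat X × r X ≡ k

  ModularPair : Subset n → Subset n → Set
  ModularPair A B = r (A ∪ B) + r (A ∩ B) ≡ r A + r B

  IsModular : Set
  IsModular = ∀ A B → IsFlat A → IsFlat B → ModularPair A B

  IsHypermodular : Set
  IsHypermodular = ∀ A B → IsFlatOfRank 3 A → IsFlatOfRank 3 B → ModularPair A B

  -- Subspaces in rank 4: point = η(M/X) with X a rank-3 flat,
  -- line = rank-2 flat, plane = rank-1 flat; η(M/X) lies on η(M/Y) iff Y ⊆ X.
  IsPoint IsLine IsPlane : Subset n → Set
  IsPoint = IsFlatOfRank 3
  IsLine  = IsFlatOfRank 2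
  IsPlane = IsFlatOfRank 1

  LiesOn : Subset n → Subset n → Set
  LiesOn X Y = Y ⊆ X

  PointLinePlaneProperty : Set
  PointLinePlaneProperty =
    ∀ P ℓ → IsPoint P → IsLine ℓ →
      ∃[ Π ] (IsPlane Π × LiesOn P Π × LiesOn ℓ Π)

  IntersectingLinesCoplanar : Set
  IntersectingLinesCoplanar =
    ∀ ℓ₁ ℓ₂ → IsLine ℓ₁ → IsLine ℓ₂ →
      (∃[ P ] (IsPoint P × LiesOn P ℓ₁ × LiesOn P ℓ₂)) →
      ∃[ Π ] (IsPlane Π × LiesOn ℓ₁ Π × LiesOn ℓ₂ Π)

-- In rank 4, hypermodularity makes two distinct points P, Q meet in a line:
-- r (P ∪ Q) = 4 forces r (P ∩ Q) = 3 + 3 − 4 = 2.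
-- (i) ⇒ (ii): modularity gives r (P ∩ ℓ) ≥ 3 + 2 − 4 = 1, so P ∩ ℓ contains a plane.
-- (ii) ⇒ (iii): if lines ℓ₁, ℓ₂ lie on the point P, pick f ∉ P; then ℓ₂ is the meet of P
-- with the point Q spanned by ℓ₂ and f, and a plane on Q and ℓ₁ also lies on P, hence on ℓ₂.
-- (iii) ⇒ (i): pairs involving a flat of rank ≤ 1 or of full rank are always modular and
-- pairs of points are modular by hypothesis, so only line/line and line/point pairs remain;
-- in both cases (iii), applied to suitable intersecting lines, yields a plane in the meet,
-- which is exactly the missing unit of rank.
module Submission where

open import Defs
open import Data.Nat using (ℕ; suc; _+_; _≤_; _<_; _≤?_; z≤n; z<s; s<s)
open import Data.Nat.Properties
open import Data.Product using (_×_; _,_; proj₂; ∃; ∃-syntax)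
open import Data.Sum using (inj₁; inj₂)
open import Data.List using (List; []; _∷_; map; filter; allFin)
open import Data.List.Relation.Unary.All using (All; []; _∷_)
open import Data.List.Relation.Unary.All.Properties using (all-filter)
open import Data.List.Relation.Unary.Any using (here; there)
import Data.List.Membership.Propositional as List
open import Data.List.Membership.Propositional.Properties using (∈-allFin; ∈-filter⁺)
open import Data.Fin using (Fin)
open import Data.Fin.Properties using (¬∀⟶∃¬)
open import Data.Fin.Subset
open import Data.Fin.Subset.Properties
open import Data.Bool.Properties using (T-≡)
open import Data.Vec using (tabulate)
open import Data.Vec.Properties using (lookup∘tabulate; []=⇒lookup; lookup⇒[]=)
open import Function using (_∘_)
open import Function.Bundles using (_⇔_; mk⇔; Equivalence)
open import Relation.Nullary using (Dec; yes; no; ¬_; does; _→-dec_)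
open import Relation.Nullary.Decidable using (isYes≗does; toWitness; dec-true)
open import Relation.Nullary.Negation using (contradiction)
open import Relation.Binary.PropositionalEquality
  using (_≡_; refl; sym; trans; subst; subst₂; cong; cong₂)

module _ {n : ℕ} where

  ∪-least : {p q s : Subset n} → p ⊆ s → q ⊆ s → p ∪ q ⊆ s
  ∪-least {p} {q} p⊆s q⊆s x∈p∪q with x∈p∪q⁻ p q x∈p∪q
  ... | inj₁ x∈p = p⊆s x∈p
  ... | inj₂ x∈q = q⊆s x∈q

  ∪-monoʳ-⊆ : {p q s : Subset n} → q ⊆ s → p ∪ q ⊆ p ∪ s
  ∪-monoʳ-⊆ {p} {q} {s} q⊆s = ∪-least (p⊆p∪q s) (⊆-trans q⊆s (q⊆p∪q p s))

  ∩-greatest : {p q s : Subset n} → s ⊆ p → s ⊆ q → s ⊆ p ∩ q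
  ∩-greatest s⊆p s⊆q x∈s = x∈p∩q⁺ (s⊆p x∈s , s⊆q x∈s)

  ⁅x⁆⊆p : {x : Fin n} {p : Subset n} → x ∈ p → ⁅ x ⁆ ⊆ p
  ⁅x⁆⊆p {p = p} x∈p y∈⁅x⁆ = subst (_∈ p) (sym (x∈⁅y⁆⇒x≡y _ y∈⁅x⁆)) x∈p

  ⊈⇒∃∈∉ : {p q : Subset n} → ¬ (p ⊆ q) → ∃ λ x → x ∈ p × x ∉ q
  ⊈⇒∃∈∉ {p} {q} p⊈q with ¬∀⟶∃¬ n (λ x → x ∈ p → x ∈ q) (λ x → x ∈? p →-dec x ∈? q)
                                 (λ p⊆q → p⊈q (λ {x} → p⊆q x))
  ... | x , x∈p⇏x∈q with x ∈? p
  ...   | yes x∈p = x , x∈p , λ x∈q → x∈p⇏x∈q (λ _ → x∈q)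
  ...   | no x∉p  = contradiction (λ x∈p → contradiction x∈p x∉p) x∈p⇏x∈q

  ∈-⋃-singletons : {x : Fin n} {xs : List (Fin n)} → x List.∈ xs → x ∈ ⋃ (map ⁅_⁆ xs)
  ∈-⋃-singletons {xs = x ∷ xs} (here refl) = p⊆p∪q (⋃ (map ⁅_⁆ xs)) (x∈⁅x⁆ x)
  ∈-⋃-singletons {xs = y ∷ xs} (there x∈xs) = q⊆p∪q ⁅ y ⁆ _ (∈-⋃-singletons x∈xs)

module MatroidProperties {n : ℕ} (M : Matroid n) where
  open Matroid M
  open ≤-Reasoning

  r-⊥ : r ⊥ ≡ 0
  r-⊥ = n≤0⇒n≡0 (subst (r ⊥ ≤_) (∣⊥∣≡0 n) (r-bound ⊥))

  r≤rankM : ∀ X → r X ≤ rankM M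
  r≤rankM X = r-mono ⊆⊤

  r-subadditive : ∀ X Y → r (X ∪ Y) ≤ r X + r Y
  r-subadditive X Y = ≤-trans (m≤m+n _ _) (r-submod X Y)

  r-submod-⊆ : ∀ {X Y} → X ⊆ Y → ∀ Z → r (Y ∪ Z) + r X ≤ r Y + r (X ∪ Z)
  r-submod-⊆ {X} {Y} X⊆Y Z = begin
    r (Y ∪ Z) + r X               ≤⟨ +-mono-≤ (r-mono Y∪Z⊆) (r-mono (∩-greatest X⊆Y (p⊆p∪q Z))) ⟩
    r (Y ∪ (X ∪ Z)) + r (Y ∩ (X ∪ Z)) ≤⟨ r-submod Y (X ∪ Z) ⟩
    r Y + r (X ∪ Z)               ∎
    where
    Y∪Z⊆ : Y ∪ Z ⊆ Y ∪ (X ∪ Z)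
    Y∪Z⊆ = ∪-monoʳ-⊆ (q⊆p∪q X Z)

  r-∪-<-antitone : ∀ {X Y Z} → X ⊆ Y → r Y < r (Y ∪ Z) → r X < r (X ∪ Z)
  r-∪-<-antitone {X} {Y} {Z} X⊆Y Y<Y∪Z =
    +-cancelˡ-< (r Y) _ _ (<-≤-trans (+-monoˡ-< (r X) Y<Y∪Z) (r-submod-⊆ X⊆Y Z))

  rank-pos⇒nonempty : ∀ {X} → 1 ≤ r X → Nonempty X
  rank-pos⇒nonempty {X} 1≤rX with nonempty? X
  ... | yes X≢∅ = X≢∅
  ... | no X≡∅ = contradiction (trans (cong r (Empty-unique X≡∅)) r-⊥)
                               (>⇒≢ 1≤rX)

  rank<rankM⇒∃∉ : ∀ {X} → r X < rankM M → ∃ λ x → x ∉ X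
  rank<rankM⇒∃∉ {X} rX<rankM = ¬∀⟶∃¬ n (_∈ X) (_∈? X)
    (λ X≡⊤ → <⇒≱ rX<rankM (r-mono (λ {x} _ → X≡⊤ x)))

  modular-pair : ∀ {A B} → r A + r B ≤ r (A ∪ B) + r (A ∩ B) → ModularPair M A B
  modular-pair {A} {B} = ≤-antisym (r-submod A B)

  modular-pair-sym : ∀ {A B} → ModularPair M A B → ModularPair M B A
  modular-pair-sym {A} {B} A∥B = begin-equality
    r (B ∪ A) + r (B ∩ A) ≡⟨ cong₂ _+_ (cong r (∪-comm B A)) (cong r (∩-comm B A)) ⟩
    r (A ∪ B) + r (A ∩ B) ≡⟨ A∥B ⟩
    r A + r B             ≡⟨ +-comm (r A) (r B) ⟩
    r B + r A             ∎

  ⊆⇒modular-pair : ∀ {A B} → A ⊆ B → ModularPair M A B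
  ⊆⇒modular-pair {A} {B} A⊆B = modular-pair (begin
    r A + r B             ≡⟨ +-comm (r A) (r B) ⟩
    r B + r A             ≤⟨ +-mono-≤ (r-mono (q⊆p∪q A B)) (r-mono (∩-greatest ⊆-refl A⊆B)) ⟩
    r (A ∪ B) + r (A ∩ B) ∎)

  flat-∪-rank-< : ∀ {F X e} → IsFlat M F → e ∉ F → e ∈ X → r F < r (F ∪ X)
  flat-∪-rank-< flatF e∉F e∈X = <-≤-trans (flatF _ e∉F) (r-mono (∪-monoʳ-⊆ (⁅x⁆⊆p e∈X)))

  flat-absorbs : ∀ {F X} → IsFlat M F → r (F ∪ X) ≤ r F → X ⊆ F
  flat-absorbs {F} flatF F∪X≤F {x} x∈X with x ∈? F
  ... | yes x∈F = x∈F
  ... | no x∉F  = contradiction F∪X≤F (<⇒≱ (flat-∪-rank-< flatF x∉F x∈X))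

  full-rank-flat-⊇ : ∀ {F X} → IsFlat M F → rankM M ≤ r F → X ⊆ F
  full-rank-flat-⊇ flatF rankM≤rF = flat-absorbs flatF (≤-trans (r≤rankM _) rankM≤rF)

  flat-∩ : ∀ {A B} → IsFlat M A → IsFlat M B → IsFlat M (A ∩ B)
  flat-∩ {A} {B} flatA flatB e e∉A∩B with e ∈? A | e ∈? B
  ... | yes e∈A | yes e∈B = contradiction (x∈p∩q⁺ (e∈A , e∈B)) e∉A∩B
  ... | no e∉A  | _       = r-∪-<-antitone (p∩q⊆p A B) (flatA e e∉A)
  ... | yes _   | no e∉B  = r-∪-<-antitone (p∩q⊆q A B) (flatB e e∉B)

  rank≤1-modular : ∀ {A B} → r A ≤ 1 → IsFlat M B → ModularPair M A B
  rank≤1-modular {A} {B} rA≤1 flatB with A ⊆? B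
  ... | yes A⊆B = ⊆⇒modular-pair A⊆B
  ... | no A⊈B with ⊈⇒∃∈∉ A⊈B
  ...   | e , e∈A , e∉B = modular-pair (begin
    r A + r B             ≤⟨ +-monoˡ-≤ (r B) rA≤1 ⟩
    suc (r B)             ≤⟨ flat-∪-rank-< flatB e∉B e∈A ⟩
    r (B ∪ A)             ≡⟨ cong r (∪-comm B A) ⟩
    r (A ∪ B)             ≤⟨ m≤m+n _ _ ⟩
    r (A ∪ B) + r (A ∩ B) ∎)

  adds-no-rank? : ∀ X x → Dec (r (X ∪ ⁅ x ⁆) ≤ r X)
  adds-no-rank? X x = r (X ∪ ⁅ x ⁆) ≤? r X

  cl : Subset n → Subset n
  cl X = tabulate (does ∘ adds-no-rank? X)

  ∈-cl⁻ : ∀ {X x} → x ∈ cl X → r (X ∪ ⁅ x ⁆) ≤ r X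
  ∈-cl⁻ {X} {x} x∈clX = toWitness (Equivalence.from T-≡
    (trans (isYes≗does (adds-no-rank? X x))
      (trans (sym (lookup∘tabulate (does ∘ adds-no-rank? X) x)) ([]=⇒lookup x∈clX))))

  ∈-cl⁺ : ∀ {X x} → r (X ∪ ⁅ x ⁆) ≤ r X → x ∈ cl X
  ∈-cl⁺ {X} {x} X∪x≤X = lookup⇒[]= x (cl X)
    (trans (lookup∘tabulate (does ∘ adds-no-rank? X) x) (dec-true (adds-no-rank? X x) X∪x≤X))

  ⊆-cl : ∀ {X} → X ⊆ cl X
  ⊆-cl x∈X = ∈-cl⁺ (r-mono (∪-least ⊆-refl (⁅x⁆⊆p x∈X)))

  r-∪-⋃-spanned : ∀ {X} (xs : List (Fin n)) → All (λ x → r (X ∪ ⁅ x ⁆) ≤ r X) xs →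
                  r (X ∪ ⋃ (map ⁅_⁆ xs)) ≤ r X
  r-∪-⋃-spanned {X} [] [] = r-mono (∪-least ⊆-refl (λ x∈⊥ → contradiction x∈⊥ ∉⊥))
  r-∪-⋃-spanned {X} (x ∷ xs) (x-spanned ∷ xs-spanned) = +-cancelʳ-≤ (r X) _ _ (begin
    r (X ∪ (⁅ x ⁆ ∪ U)) + r X ≤⟨ +-monoˡ-≤ (r X) (r-mono regroup) ⟩
    r ((X ∪ U) ∪ ⁅ x ⁆) + r X ≤⟨ r-submod-⊆ (p⊆p∪q U) ⁅ x ⁆ ⟩
    r (X ∪ U) + r (X ∪ ⁅ x ⁆) ≤⟨ +-mono-≤ (r-∪-⋃-spanned xs xs-spanned) x-spanned ⟩
    r X + r X                 ∎)
    where
    U : Subset n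
    U = ⋃ (map ⁅_⁆ xs)
    regroup : X ∪ (⁅ x ⁆ ∪ U) ⊆ (X ∪ U) ∪ ⁅ x ⁆
    regroup = ∪-least (⊆-trans (p⊆p∪q U) (p⊆p∪q ⁅ x ⁆))
                      (∪-least (q⊆p∪q (X ∪ U) ⁅ x ⁆) (⊆-trans (q⊆p∪q X U) (p⊆p∪q ⁅ x ⁆)))

  r-cl : ∀ X → r (cl X) ≡ r X
  r-cl X = ≤-antisym (≤-trans (r-mono clX⊆) (r-∪-⋃-spanned spanned (all-filter (adds-no-rank? X) (allFin n))))
                     (r-mono ⊆-cl)
    where
    spanned : List (Fin n)
    spanned = filter (adds-no-rank? X) (allFin n)
    clX⊆ : cl X ⊆ X ∪ ⋃ (map ⁅_⁆ spanned)
    clX⊆ x∈clX = q⊆p∪q X _ (∈-⋃-singletons (∈-filter⁺ (adds-no-rank? X) (∈-allFin _) (∈-cl⁻ x∈clX)))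

  cl-flat : ∀ X → IsFlat M (cl X)
  cl-flat X e e∉clX = begin-strict
    r (cl X)         ≡⟨ r-cl X ⟩
    r X              <⟨ ≰⇒> (e∉clX ∘ ∈-cl⁺) ⟩
    r (X ∪ ⁅ e ⁆)    ≤⟨ r-mono (∪-least (⊆-trans ⊆-cl (p⊆p∪q ⁅ e ⁆)) (q⊆p∪q (cl X) ⁅ e ⁆)) ⟩
    r (cl X ∪ ⁅ e ⁆) ∎

  cl-least : ∀ {X F} → IsFlat M F → X ⊆ F → cl X ⊆ F
  cl-least {X} {F} flatF X⊆F {x} x∈clX with x ∈? F
  ... | yes x∈F = x∈F
  ... | no x∉F  = contradiction (∈-cl⁻ x∈clX) (<⇒≱ (r-∪-<-antitone X⊆F (flatF x x∉F)))

  plane-⊆-flat : Loopless M → ∀ {F} → IsFlat M F → 1 ≤ r F →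
                 ∃[ Π ] (IsFlatOfRank M 1 Π × Π ⊆ F)
  plane-⊆-flat loopless flatF 1≤rF with rank-pos⇒nonempty 1≤rF
  ... | x , x∈F = cl ⁅ x ⁆ , (cl-flat ⁅ x ⁆ , trans (r-cl ⁅ x ⁆) (loopless x))
                , cl-least flatF (⁅x⁆⊆p x∈F)

  extend-flat : Loopless M → ∀ {k F e} → IsFlatOfRank M k F → e ∉ F →
                IsFlatOfRank M (suc k) (cl (F ∪ ⁅ e ⁆))
  extend-flat loopless {k} {F} {e} (flatF , rF) e∉F =
    cl-flat _ , trans (r-cl _) (≤-antisym upper lower)
    where
    upper : r (F ∪ ⁅ e ⁆) ≤ suc k
    upper = begin
      r (F ∪ ⁅ e ⁆)   ≤⟨ r-subadditive F ⁅ e ⁆ ⟩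
      r F + r ⁅ e ⁆   ≡⟨ cong₂ _+_ rF (loopless e) ⟩
      k + 1           ≡⟨ +-comm k 1 ⟩
      suc k           ∎
    lower : suc k ≤ r (F ∪ ⁅ e ⁆)
    lower = subst (λ k → suc k ≤ _) rF (flatF e e∉F)

  common-plane⇒1≤r-∩ : ∀ {A B} → ∃[ Π ] (IsPlane M Π × Π ⊆ A × Π ⊆ B) → 1 ≤ r (A ∩ B)
  common-plane⇒1≤r-∩ {A} {B} (Π , (_ , rΠ) , Π⊆A , Π⊆B) =
    subst (_≤ r (A ∩ B)) rΠ (r-mono (∩-greatest Π⊆A Π⊆B))

module Rank4Hypermodular {n : ℕ} (M : Matroid n) (loopless : Loopless M)
                         (rank4 : rankM M ≡ 4) (hyper : IsHypermodular M) where
  open Matroid M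
  open MatroidProperties M
  open ≤-Reasoning

  r≤4 : ∀ X → r X ≤ 4
  r≤4 X = subst (r X ≤_) rank4 (r≤rankM X)

  rank<4⇒∃∉ : ∀ {X k} → r X ≡ k → k < 4 → ∃ λ x → x ∉ X
  rank<4⇒∃∉ rX≡k k<4 = rank<rankM⇒∃∉ (subst₂ _<_ (sym rX≡k) (sym rank4) k<4)

  distinct-points-meet-in-line : ∀ {P Q e} → IsPoint M P → IsPoint M Q → e ∈ Q → e ∉ P →
                                 IsLine M (P ∩ Q)
  distinct-points-meet-in-line {P} {Q} pointP@(flatP , rP) pointQ@(flatQ , rQ) e∈Q e∉P =
    flat-∩ flatP flatQ , +-cancelˡ-≡ 4 _ _ (begin-equality
      4 + r (P ∩ Q)         ≡⟨ cong (_+ r (P ∩ Q)) r-∪≡4 ⟨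
      r (P ∪ Q) + r (P ∩ Q) ≡⟨ hyper P Q pointP pointQ ⟩
      r P + r Q             ≡⟨ cong₂ _+_ rP rQ ⟩
      4 + 2                 ∎)
    where
    r-∪≡4 : r (P ∪ Q) ≡ 4
    r-∪≡4 = ≤-antisym (r≤4 _) (subst (λ k → suc k ≤ r (P ∪ Q)) rP (flat-∪-rank-< flatP e∉P e∈Q))

  line-is-meet-of-points : ∀ {P ℓ} → IsPoint M P → IsLine M ℓ → ℓ ⊆ P →
                           ∃[ Q ] (IsPoint M Q × ℓ ⊆ Q × P ∩ Q ⊆ ℓ)
  line-is-meet-of-points {P} {ℓ} pointP@(_ , rP) lineℓ@(flatℓ , rℓ) ℓ⊆P
    with rank<4⇒∃∉ rP (s<s (s<s (s<s z<s)))
  ... | f , f∉P = Q , pointQ , ℓ⊆Q ,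
        flat-absorbs flatℓ (begin
          r (ℓ ∪ (P ∩ Q)) ≤⟨ r-mono (∪-least (∩-greatest ℓ⊆P ℓ⊆Q) ⊆-refl) ⟩
          r (P ∩ Q)       ≡⟨ trans (proj₂ linePQ) (sym rℓ) ⟩
          r ℓ             ∎)
    where
    Q : Subset n
    Q = cl (ℓ ∪ ⁅ f ⁆)
    pointQ : IsPoint M Q
    pointQ = extend-flat loopless lineℓ (f∉P ∘ ℓ⊆P)
    ℓ⊆Q : ℓ ⊆ Q
    ℓ⊆Q = ⊆-trans (p⊆p∪q ⁅ f ⁆) ⊆-cl
    linePQ : IsLine M (P ∩ Q)
    linePQ = distinct-points-meet-in-line pointP pointQ (⊆-cl (q⊆p∪q ℓ ⁅ f ⁆ (x∈⁅x⁆ f))) f∉P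

  modular⇒point-line-plane : IsModular M → PointLinePlaneProperty M
  modular⇒point-line-plane modular P ℓ (flatP , rP) (flatℓ , rℓ)
    with plane-⊆-flat loopless (flat-∩ flatP flatℓ) 1≤r-∩
    where
    1≤r-∩ : 1 ≤ r (P ∩ ℓ)
    1≤r-∩ = +-cancelˡ-≤ 4 _ _ (begin
      4 + 1                 ≡⟨ cong₂ _+_ rP rℓ ⟨
      r P + r ℓ             ≡⟨ modular P ℓ flatP flatℓ ⟨
      r (P ∪ ℓ) + r (P ∩ ℓ) ≤⟨ +-monoˡ-≤ _ (r≤4 _) ⟩
      4 + r (P ∩ ℓ)         ∎)
  ... | Π , planeΠ , Π⊆P∩ℓ = Π , planeΠ , ⊆-trans Π⊆P∩ℓ (p∩q⊆p P ℓ) , ⊆-trans Π⊆P∩ℓ (p∩q⊆q P ℓ)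

  point-line-plane⇒coplanar : PointLinePlaneProperty M → IntersectingLinesCoplanar M
  point-line-plane⇒coplanar planes ℓ₁ ℓ₂ line₁ line₂ (P , pointP , ℓ₁⊆P , ℓ₂⊆P)
    with line-is-meet-of-points pointP line₂ ℓ₂⊆P
  ... | Q , pointQ , _ , P∩Q⊆ℓ₂ with planes Q ℓ₁ pointQ line₁
  ...   | Π , planeΠ , Π⊆Q , Π⊆ℓ₁ =
          Π , planeΠ , Π⊆ℓ₁ , ⊆-trans (∩-greatest (⊆-trans Π⊆ℓ₁ ℓ₁⊆P) Π⊆Q) P∩Q⊆ℓ₂

  coplanar⇒lines-modular : IntersectingLinesCoplanar M →
                           ∀ {A B} → IsLine M A → IsLine M B → ModularPair M A B
  coplanar⇒lines-modular coplanar {A} {B} lineA@(flatA , rA) lineB@(_ , rB) with B ⊆? A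
  ... | yes B⊆A = modular-pair-sym (⊆⇒modular-pair B⊆A)
  ... | no B⊈A = modular-pair (subst (_≤ r (A ∪ B) + r (A ∩ B)) (sym (cong₂ _+_ rA rB)) 4≤span+meet)
    where
    3≤r-∪ : 3 ≤ r (A ∪ B)
    3≤r-∪ = let e , e∈B , e∉A = ⊈⇒∃∈∉ B⊈A in
            subst (λ k → suc k ≤ r (A ∪ B)) rA (flat-∪-rank-< flatA e∉A e∈B)
    4≤span+meet : 4 ≤ r (A ∪ B) + r (A ∩ B)
    4≤span+meet with m≤n⇒m<n∨m≡n 3≤r-∪
    ... | inj₁ 4≤r-∪ = ≤-trans 4≤r-∪ (m≤m+n _ _)
    ... | inj₂ 3≡r-∪ = +-mono-≤ 3≤r-∪ (common-plane⇒1≤r-∩ (coplanar A B lineA lineB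
          (cl (A ∪ B) , (cl-flat _ , trans (r-cl _) (sym 3≡r-∪)) ,
           ⊆-trans (p⊆p∪q B) ⊆-cl , ⊆-trans (q⊆p∪q A B) ⊆-cl)))

  coplanar⇒line-point-modular : IntersectingLinesCoplanar M →
                                ∀ {ℓ P} → IsLine M ℓ → IsPoint M P → ModularPair M ℓ P
  coplanar⇒line-point-modular coplanar {ℓ} {P} lineℓ@(flatℓ , rℓ) pointP@(flatP , rP)
    with ℓ ⊆? P
  ... | yes ℓ⊆P = ⊆⇒modular-pair ℓ⊆P
  ... | no ℓ⊈P with ⊈⇒∃∈∉ ℓ⊈P | rank<4⇒∃∉ rℓ (s<s (s<s z<s))
  ...   | e , e∈ℓ , e∉P | f , f∉ℓ = modular-pair (begin
          r ℓ + r P             ≡⟨ cong₂ _+_ rℓ rP ⟩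
          4 + 1                 ≤⟨ +-mono-≤ 4≤r-∪ 1≤r-∩ ⟩
          r (ℓ ∪ P) + r (ℓ ∩ P) ∎)
    where
    4≤r-∪ : 4 ≤ r (ℓ ∪ P)
    4≤r-∪ = subst₂ (λ k X → suc k ≤ r X) rP (∪-comm P ℓ) (flat-∪-rank-< flatP e∉P e∈ℓ)
    Q : Subset n
    Q = cl (ℓ ∪ ⁅ f ⁆)
    pointQ : IsPoint M Q
    pointQ = extend-flat loopless lineℓ f∉ℓ
    ℓ⊆Q : ℓ ⊆ Q
    ℓ⊆Q = ⊆-trans (p⊆p∪q ⁅ f ⁆) ⊆-cl
    1≤r-∩ : 1 ≤ r (ℓ ∩ P)
    1≤r-∩ with coplanar ℓ (P ∩ Q) lineℓ
                 (distinct-points-meet-in-line pointP pointQ (ℓ⊆Q e∈ℓ) e∉P)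
                 (Q , pointQ , ℓ⊆Q , p∩q⊆q P Q)
    ... | Π , planeΠ , Π⊆ℓ , Π⊆P∩Q =
          common-plane⇒1≤r-∩ (Π , planeΠ , Π⊆ℓ , ⊆-trans Π⊆P∩Q (p∩q⊆p P Q))

  coplanar⇒modular : IntersectingLinesCoplanar M → IsModular M
  coplanar⇒modular coplanar A B flatA flatB = by-ranks (r A) (r B) refl refl
    where
    full-rank : ∀ {X} → 4 ≤ r X → rankM M ≤ r X
    full-rank {X} = subst (_≤ r X) (sym rank4)
    by-ranks : ∀ a b → r A ≡ a → r B ≡ b → ModularPair M A B
    by-ranks 0 _ rA _ = rank≤1-modular (≤-trans (≤-reflexive rA) z≤n) flatB
    by-ranks 1 _ rA _ = rank≤1-modular (≤-reflexive rA) flatB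
    by-ranks _ 0 _ rB = modular-pair-sym (rank≤1-modular (≤-trans (≤-reflexive rB) z≤n) flatA)
    by-ranks _ 1 _ rB = modular-pair-sym (rank≤1-modular (≤-reflexive rB) flatA)
    by-ranks (suc (suc (suc (suc a)))) _ rA _ =
      modular-pair-sym (⊆⇒modular-pair (full-rank-flat-⊇ flatA
        (full-rank (subst (4 ≤_) (sym rA) (m≤m+n 4 a)))))
    by-ranks _ (suc (suc (suc (suc b)))) _ rB =
      ⊆⇒modular-pair (full-rank-flat-⊇ flatB (full-rank (subst (4 ≤_) (sym rB) (m≤m+n 4 b))))
    by-ranks 2 2 rA rB = coplanar⇒lines-modular coplanar (flatA , rA) (flatB , rB)
    by-ranks 2 3 rA rB = coplanar⇒line-point-modular coplanar (flatA , rA) (flatB , rB)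
    by-ranks 3 2 rA rB =
      modular-pair-sym (coplanar⇒line-point-modular coplanar (flatB , rB) (flatA , rA))
    by-ranks 3 3 rA rB = hyper A B (flatA , rA) (flatB , rB)

proposition5p3 : ∀ {n : ℕ} (M : Matroid n) → Loopless M → rankM M ≡ 4 →
    IsHypermodular M →
    (IsModular M ⇔ PointLinePlaneProperty M) × (IsModular M ⇔ IntersectingLinesCoplanar M)
proposition5p3 M loopless rank4 hyper =
    mk⇔ modular⇒point-line-plane (coplanar⇒modular ∘ point-line-plane⇒coplanar)
  , mk⇔ (point-line-plane⇒coplanar ∘ modular⇒point-line-plane) coplanar⇒modular
  where open Rank4Hypermodular M loopless rank4 hyper
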